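{- Let $e$ be a closed expression such that, for every monoid $(M,\cdot,\epsilon)$, we have $\epsilon \Vdash e \in \llbracket \forall \alpha.\, \alpha \twoheadrightarrow (\alpha \twoheadrightarrow (\alpha \bullet \alpha))\rrbracket$ (with respect to the logical predicate parameterized by $M$ and the empty mapping $S$). Then $e$ is extensionally equal to $\lambda x.\,\lambda y.\,(x,y)$: for all closed values $v,w$, the expression $e\,v\,w$ evaluates to $(v,w)$. In particular, $e$ is not extensionally equal to $\lambda x.\,\lambda y.\,(y,x)$.
   Context: Untyped (Curry-style) expressions: $e ::= x \mid (e_1,e_2) \mid \mathbf{match}\; e\; ((x,y)\Rightarrow e') \mid \lambda x.\,e \mid e_1\,e_2$; application is left-associative. Values are $\lambda x.\,e$ and pairs $(v_1,v_2)$ of values. Call-by-value big-step evaluation $e\hookrightarrow v$ is given by: $\lambda x.e \hookrightarrow \lambda x.e$; $e_1\,e_2\hookrightarrow v$ if $e_1\hookrightarrow\lambda x.e_1'$, $e_2\hookrightarrow v_2$ and $[v_2/x]e_1'\hookrightarrow v$; $(e_1,e_2)\hookrightarrow(v_1,v_2)$ if $e_1\hookrightarrow v_1$ and $e_2\hookrightarrow v_2$; $\mathbf{match}\;e\;((x,y)\Rightarrow e')\hookrightarrow v'$ if $e\hookrightarrow(v_1,v_2)$ and $[v_1/x,v_2/y]e'\hookrightarrow v'$. Types: $A,B ::= \alpha \mid A\bullet B \mid A\backslash B \mid A\twoheadrightarrow B \mid \forall\alpha.\,A$. Logical predicate, parameterized by a monoid $(M,\cdot,\epsilon)$ and a mapping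 $S$ from type variables to relations between elements of $M$ and closed values: $m\Vdash^S e\in\llbracket A\rrbracket$ iff $e\hookrightarrow v$ for some $v$ with $m\Vdash^S v\in[A]$; $m\Vdash^S v\in[\alpha]$ iff $m \mathrel{S(\alpha)} v$; $m\Vdash^S v\in[A\bullet B]$ iff there are $m_1,m_2$ with $m=m_1\cdot m_2$, $v=(v_1,v_2)$, $m_1\Vdash^S v_1\in[A]$ and $m_2\Vdash^S v_2\in[B]$; $m\Vdash^S v\in[A\twoheadrightarrow B]$ iff for all $k,w$ with $k\Vdash^S w\in[A]$ we have $m\cdot k\Vdash^S v\,w\in\llbracket B\rrbracket$; $m\Vdash^S v\in[A\backslash B]$ iff for all $k,w$ with $k\Vdash^S w\in[A]$ we have $k\cdot m\Vdash^S v\,w\in\llbracket B\rrbracket$; $m\Vdash^S v\in[\forall\alpha.\,A]$ iff for every closed type $B$ and every relation $R_B$ between elements of $M$ and closed values, $m\Vdash^{S,\alpha\mapsto R_B} v\in[A]$. We write $\Vdash$ for $\Vdash^S$ with $S$ empty. -}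

module Defs where

open import Level using (Level; 0ℓ; Lift) renaming (suc to lsuc)
open import Data.Nat using (ℕ; _≟_)
open import Data.Product using (Σ; ∃; _×_; _,_; proj₁)
open import Data.Empty using (⊥)
open import Relation.Nullary using (¬_; yes; no)
open import Relation.Binary.PropositionalEquality using (_≡_)
open import Algebra.Bundles using (Monoid)

Var : Set
Var = ℕ

data Expr : Set where
  var   : Var → Expr
  pair  : Expr → Expr → Expr
  match : Expr → Var → Var → Expr → Expr   -- match e ((x,y) ⇒ e')
  lam   : Var → Expr → Expr
  app   : Expr → Expr → Expr

data IsValue : Expr → Set where
  v-lam  : ∀ x e → IsValue (lam x e)
  v-pair : ∀ {v₁ v₂} → IsValue v₁ → IsValue v₂ → IsValue (pair v₁ v₂)

data FreeIn (x : Var) : Expr → Set where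
  fi-var    : FreeIn x (var x)
  fi-pair₁  : ∀ {e₁ e₂} → FreeIn x e₁ → FreeIn x (pair e₁ e₂)
  fi-pair₂  : ∀ {e₁ e₂} → FreeIn x e₂ → FreeIn x (pair e₁ e₂)
  fi-match₁ : ∀ {e y z e'} → FreeIn x e → FreeIn x (match e y z e')
  fi-match₂ : ∀ {e y z e'} → ¬ (x ≡ y) → ¬ (x ≡ z) → FreeIn x e' → FreeIn x (match e y z e')
  fi-lam    : ∀ {y e} → ¬ (x ≡ y) → FreeIn x e → FreeIn x (lam y e)
  fi-app₁   : ∀ {e₁ e₂} → FreeIn x e₁ → FreeIn x (app e₁ e₂)
  fi-app₂   : ∀ {e₁ e₂} → FreeIn x e₂ → FreeIn x (app e₁ e₂)

Closed : Expr → Set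
Closed e = ∀ x → ¬ FreeIn x e

CVal : Set
CVal = Σ Expr (λ v → IsValue v × Closed v)

-- Substitution [v/x]e (only ever used with closed v, so no capture issues)
subst : Expr → Var → Expr → Expr
subst v x (var y) with x ≟ y
... | yes _ = v
... | no _  = var y
subst v x (pair e₁ e₂) = pair (subst v x e₁) (subst v x e₂)
subst v x (match e y z e') with x ≟ y | x ≟ z
... | no _  | no _  = match (subst v x e) y z (subst v x e')
... | _     | _     = match (subst v x e) y z e'
subst v x (lam y e) with x ≟ y
... | yes _ = lam y e
... | no _  = lam y (subst v x e)
subst v x (app e₁ e₂) = app (subst v x e₁) (subst v x e₂)

infix 4 _↪_
data _↪_ : Expr → Expr → Set where
  ev-lam   : ∀ {x e} → lam x e ↪ lam x e
  ev-app   : ∀ {e₁ e₂ x e₁' v₂ v} → e₁ ↪ lam x e₁' → e₂ ↪ v₂ →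
             subst v₂ x e₁' ↪ v → app e₁ e₂ ↪ v
  ev-pair  : ∀ {e₁ e₂ v₁ v₂} → e₁ ↪ v₁ → e₂ ↪ v₂ → pair e₁ e₂ ↪ pair v₁ v₂
  ev-match : ∀ {e x y e' v₁ v₂ v'} → e ↪ pair v₁ v₂ →
             subst v₁ x (subst v₂ y e') ↪ v' → match e x y e' ↪ v'

infixr 7 _•_
infixr 5 _↠_
data Ty : Set where
  tvar : Var → Ty
  _•_  : Ty → Ty → Ty
  _∖_  : Ty → Ty → Ty
  _↠_  : Ty → Ty → Ty
  ∀̇    : Var → Ty → Ty

module Pred (M : Monoid 0ℓ 0ℓ) where
  open Monoid M

  Rel : Set₁
  Rel = Carrier → CVal → Set

  Env : Set₁
  Env = Var → Rel

  emptyEnv : Env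
  emptyEnv _ _ _ = ⊥

  extend : Env → Var → Rel → Env
  extend S α R β with α ≟ β
  ... | yes _ = R
  ... | no _  = S β

  mutual
    V : Ty → Env → Carrier → CVal → Set₁
    V (tvar α) S m v = Lift (lsuc 0ℓ) (S α m v)
    V (A • B) S m v = Σ Carrier λ m₁ → Σ Carrier λ m₂ → Σ CVal λ v₁ → Σ CVal λ v₂ →
      Lift (lsuc 0ℓ) (m ≈ (m₁ ∙ m₂)) × Lift (lsuc 0ℓ) (proj₁ v ≡ pair (proj₁ v₁) (proj₁ v₂)) ×
      V A S m₁ v₁ × V B S m₂ v₂
    V (A ↠ B) S m v = ∀ (k : Carrier) (w : CVal) → V A S k w →
      E B S (m ∙ k) (app (proj₁ v) (proj₁ w))
    V (A ∖ B) S m v = ∀ (k : Carrier) (w : CVal) → V A S k w →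
      E B S (k ∙ m) (app (proj₁ v) (proj₁ w))
    V (∀̇ α A) S m v = ∀ (B : Ty) (R : Rel) → V A (extend S α R) m v

    E : Ty → Env → Carrier → Expr → Set₁
    E A S m e = Σ CVal λ v → Lift (lsuc 0ℓ) (e ↪ proj₁ v) × V A S m v

pairTy : Ty
pairTy = ∀̇ 0 (tvar 0 ↠ (tvar 0 ↠ (tvar 0 • tvar 0)))

Valid : Monoid 0ℓ 0ℓ → Ty → Expr → Set₁
Valid M A e = Pred.E M A (Pred.emptyEnv M) (Monoid.ε M) e

{-# OPTIONS --safe #-}
-- Take the free monoid on two letters, lists of booleans, and interpret α by the relation
-- that relates the word [true] only to v and the word [false] only to w. The predicate then
-- says that e v w evaluates to a pair (u₁ , u₂) with u₁ related to m₁, u₂ related to m₂ and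
-- m₁ m₂ = [true , false]. Related words are single letters, so m₁ = [true] and m₂ = [false],
-- whence (u₁ , u₂) = (v , w). Evaluation is deterministic, so e v w cannot also evaluate to
-- (w , v) once v and w are distinct.
module Submission where

open import Defs
open import Level using (0ℓ; lift)
open import Data.Bool using (Bool; true; false)
open import Data.List using (List; []; _∷_; [_]; _++_)
open import Data.List.Properties using (++-monoid)
open import Data.Product using (Σ-syntax; _×_; _,_; proj₁)
open import Relation.Nullary using (¬_)
open import Relation.Binary.PropositionalEquality using (_≡_; refl; cong₂)
open import Algebra.Bundles using (Monoid)

↪-value : ∀ {e u} → e ↪ u → IsValue u
↪-value ev-lam           = v-lam _ _
↪-value (ev-app _ _ ↪u)  = ↪-value ↪u
↪-value (ev-pair ↪u ↪w)  = v-pair (↪-value ↪u) (↪-value ↪w)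
↪-value (ev-match _ ↪u)  = ↪-value ↪u

value-↪-inv : ∀ {u w} → IsValue u → u ↪ w → w ≡ u
value-↪-inv (v-lam _ _)  ev-lam            = refl
value-↪-inv (v-pair u v) (ev-pair u↪ v↪) = cong₂ pair (value-↪-inv u u↪) (value-↪-inv v v↪)

↪-deterministic : ∀ {e u w} → e ↪ u → e ↪ w → u ≡ w
↪-deterministic ev-lam ev-lam = refl
↪-deterministic (ev-app f↪ a↪ b↪) (ev-app f↪′ a↪′ b↪′)
  with ↪-deterministic f↪ f↪′ | ↪-deterministic a↪ a↪′
... | refl | refl = ↪-deterministic b↪ b↪′
↪-deterministic (ev-pair a↪ b↪) (ev-pair a↪′ b↪′) =
  cong₂ pair (↪-deterministic a↪ a↪′) (↪-deterministic b↪ b↪′)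
↪-deterministic (ev-match p↪ b↪) (ev-match p↪′ b↪′)
  with ↪-deterministic p↪ p↪′
... | refl = ↪-deterministic b↪ b↪′

↪-appˡ : ∀ {e u a r} → e ↪ u → app u a ↪ r → app e a ↪ r
↪-appˡ e↪u (ev-app u↪ a↪ b↪) with value-↪-inv (↪-value e↪u) u↪
... | refl = ev-app e↪u a↪ b↪

module _ (M : Monoid 0ℓ 0ℓ) where
  open Monoid M
  open Pred M

  pairTy-free-theorem : ∀ {e m k} → Valid M pairTy e → (R : Rel) (v w : CVal) → R m v → R k w →
    Σ[ m₁ ∈ Carrier ] Σ[ m₂ ∈ Carrier ] Σ[ u₁ ∈ CVal ] Σ[ u₂ ∈ CVal ]
      app (app e (proj₁ v)) (proj₁ w) ↪ pair (proj₁ u₁) (proj₁ u₂)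
      × (ε ∙ m) ∙ k ≈ m₁ ∙ m₂ × R m₁ u₁ × R m₂ u₂
  pairTy-free-theorem (_ , lift e↪f , f∈) R v w v∈R w∈R
    with f∈ (tvar 0) R _ v (lift v∈R)
  ... | _ , lift fv↪g , g∈ with g∈ _ w (lift w∈R)
  ... | (_ , _) , lift gw↪p , m₁ , m₂ , u₁ , u₂ , lift split , lift refl , lift u₁∈R , lift u₂∈R =
    m₁ , m₂ , u₁ , u₂ , ↪-appˡ (↪-appˡ e↪f fv↪g) gw↪p , split , u₁∈R , u₂∈R

data Tagged (v w : CVal) : List Bool → CVal → Set where
  tag-left  : ∀ {u} → proj₁ u ≡ proj₁ v → Tagged v w [ true ]  u
  tag-right : ∀ {u} → proj₁ u ≡ proj₁ w → Tagged v w [ false ] u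

tagged-split : ∀ {v w m₁ m₂ u₁ u₂} → true ∷ false ∷ [] ≡ m₁ ++ m₂ →
  Tagged v w m₁ u₁ → Tagged v w m₂ u₂ → proj₁ u₁ ≡ proj₁ v × proj₁ u₂ ≡ proj₁ w
tagged-split refl (tag-left u₁≡v) (tag-right u₂≡w) = u₁≡v , u₂≡w

valid-pairTy⇒pairs-in-order : ∀ {e} → ((M : Monoid 0ℓ 0ℓ) → Valid M pairTy e) →
  (v w : CVal) → app (app e (proj₁ v)) (proj₁ w) ↪ pair (proj₁ v) (proj₁ w)
valid-pairTy⇒pairs-in-order valid v w
  with pairTy-free-theorem (++-monoid Bool) (valid (++-monoid Bool))
         (Tagged v w) v w (tag-left refl) (tag-right refl)
... | _ , _ , _ , _ , ↪p , split , u₁∈ , u₂∈ with tagged-split split u₁∈ u₂∈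
... | refl , refl = ↪p

identity : CVal
identity = lam 0 (var 0) , v-lam 0 (var 0) , λ { _ (fi-lam x≢0 fi-var) → x≢0 refl }

identity-pair : CVal
identity-pair = pair (proj₁ identity) (proj₁ identity) , v-pair (v-lam 0 (var 0)) (v-lam 0 (var 0)) , closed
  where
  closed : Closed (pair (proj₁ identity) (proj₁ identity))
  closed _ (fi-pair₁ (fi-lam x≢0 fi-var)) = x≢0 refl
  closed _ (fi-pair₂ (fi-lam x≢0 fi-var)) = x≢0 refl

mainTheorem1 : (e : Expr) → Closed e → ((M : Monoid 0ℓ 0ℓ) → Valid M pairTy e) →
    ((v w : CVal) → app (app e (proj₁ v)) (proj₁ w) ↪ pair (proj₁ v) (proj₁ w))
    × ¬ ((v w : CVal) → app (app e (proj₁ v)) (proj₁ w) ↪ pair (proj₁ w) (proj₁ v))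
mainTheorem1 e _ valid = in-order , not-swapped
  where
  in-order : (v w : CVal) → app (app e (proj₁ v)) (proj₁ w) ↪ pair (proj₁ v) (proj₁ w)
  in-order = valid-pairTy⇒pairs-in-order valid

  not-swapped : ¬ ((v w : CVal) → app (app e (proj₁ v)) (proj₁ w) ↪ pair (proj₁ w) (proj₁ v))
  not-swapped swapped
    with ↪-deterministic (in-order identity identity-pair) (swapped identity identity-pair)
  ... | ()
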